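{- (1) Any biclosed monoidal structure $(\mathsf{DiGraph},\otimes,J_0)$ is completely determined (up to isomorphism) by the directed graph $J_1\otimes J_1$. (2) Any biclosed monoidal structure $(\mathsf{Graph},\otimes,I_0)$ is completely determined (up to isomorphism) by the graph $I_1\otimes I_1$.
   Context: $\mathsf{DiGraph}$ is the category of directed reflexive graphs (sets with a reflexive relation, relation-preserving maps); $\mathsf{Graph}$ is the category of undirected reflexive graphs (sets with a reflexive symmetric relation, relation-preserving maps). $J_0$ (resp. $I_0$) is the one-vertex graph; $J_1$ is the directed graph with vertices $0,1$ and a single non-loop edge $0\rightsquigarrow 1$; $I_1$ is the undirected graph with vertices $0,1$ and a single non-loop edge $0\sim 1$. A monoidal category is biclosed if for every object $X$ both $X\otimes-$ and $-\otimes X$ have right adjoints. -}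

module Defs where

open import Data.Unit using (⊤; tt)
open import Data.Bool using (Bool; false; true; _≤_; b≤b; f≤t)
open import Data.Product using (Σ; _×_; _,_)
open import Relation.Binary.PropositionalEquality using (_≡_)

record DiGraph : Set₁ where
  field
    V      : Set
    E      : V → V → Set
    E-refl : ∀ x → E x x
open DiGraph public

record Graph : Set₁ where
  field
    dg    : DiGraph
    E-sym : ∀ {x y} → E dg x y → E dg y x
open Graph public

record DHom (X Y : DiGraph) : Set where
  field
    fun  : V X → V Y
    pres : ∀ {x y} → E X x y → E Y (fun x) (fun y)
open DHom public

J₀ : DiGraph
J₀ = record { V = ⊤ ; E = λ _ _ → ⊤ ; E-refl = λ _ → tt }

-- vertices 0 = false, 1 = true; single non-loop edge 0 ⇝ 1
J₁ : DiGraph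
J₁ = record { V = Bool ; E = _≤_ ; E-refl = λ _ → b≤b }

I₀ : Graph
I₀ = record { dg = J₀ ; E-sym = λ _ → tt }

-- vertices 0, 1 with the (symmetric) edge 0 ∼ 1 (plus loops)
I₁ : Graph
I₁ = record { dg = record { V = Bool ; E = λ _ _ → ⊤ ; E-refl = λ _ → tt }
            ; E-sym = λ _ → tt }

module Cat {Ob : Set₁} (U : Ob → DiGraph) where

  Hom : Ob → Ob → Set
  Hom X Y = DHom (U X) (U Y)

  infix 4 _≈_
  _≈_ : ∀ {X Y} → Hom X Y → Hom X Y → Set
  f ≈ g = ∀ x → fun f x ≡ fun g x

  id : ∀ {X} → Hom X X
  id = record { fun = λ x → x ; pres = λ e → e }

  infixr 9 _∘_
  _∘_ : ∀ {X Y Z} → Hom Y Z → Hom X Y → Hom X Z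
  g ∘ f = record { fun = λ x → fun g (fun f x) ; pres = λ e → pres g (pres f e) }

  record Iso (X Y : Ob) : Set where
    field
      to     : Hom X Y
      from   : Hom Y X
      from∘to : from ∘ to ≈ id
      to∘from : to ∘ from ≈ id

  -- A functor F (object part F₀, morphism part F₁) has a right adjoint:
  -- for every Z a universal arrow ε_Z : F (R Z) → Z from F to Z.
  record RightAdjoint (F₀ : Ob → Ob)
                      (F₁ : ∀ {Y Y'} → Hom Y Y' → Hom (F₀ Y) (F₀ Y')) : Set₁ where
    field
      R    : Ob → Ob
      ε    : ∀ Z → Hom (F₀ (R Z)) Z
      univ : ∀ {Y Z} (f : Hom (F₀ Y) Z) →
             Σ (Hom Y (R Z)) λ g →
               (ε Z ∘ F₁ g ≈ f) × (∀ (g' : Hom Y (R Z)) → ε Z ∘ F₁ g' ≈ f → g' ≈ g)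

  record Monoidal (𝟙 : Ob) : Set₁ where
    infixr 10 _⊗₀_ _⊗₁_
    field
      _⊗₀_ : Ob → Ob → Ob
      _⊗₁_ : ∀ {X X' Y Y'} → Hom X X' → Hom Y Y' → Hom (X ⊗₀ Y) (X' ⊗₀ Y')
      ⊗-resp : ∀ {X X' Y Y'} {f f' : Hom X X'} {g g' : Hom Y Y'} →
               f ≈ f' → g ≈ g' → f ⊗₁ g ≈ f' ⊗₁ g'
      ⊗-id   : ∀ {X Y} → id {X} ⊗₁ id {Y} ≈ id
      ⊗-∘    : ∀ {X X' X'' Y Y' Y''}
               {f : Hom X X'} {f' : Hom X' X''} {g : Hom Y Y'} {g' : Hom Y' Y''} →
               (f' ∘ f) ⊗₁ (g' ∘ g) ≈ (f' ⊗₁ g') ∘ (f ⊗₁ g)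
      α      : ∀ X Y Z → Iso ((X ⊗₀ Y) ⊗₀ Z) (X ⊗₀ (Y ⊗₀ Z))
      λ≅     : ∀ X → Iso (𝟙 ⊗₀ X) X
      ρ≅     : ∀ X → Iso (X ⊗₀ 𝟙) X
      α-nat  : ∀ {X X' Y Y' Z Z'} (f : Hom X X') (g : Hom Y Y') (h : Hom Z Z') →
               Iso.to (α X' Y' Z') ∘ ((f ⊗₁ g) ⊗₁ h) ≈ (f ⊗₁ (g ⊗₁ h)) ∘ Iso.to (α X Y Z)
      λ-nat  : ∀ {X X'} (f : Hom X X') →
               Iso.to (λ≅ X') ∘ (id ⊗₁ f) ≈ f ∘ Iso.to (λ≅ X)
      ρ-nat  : ∀ {X X'} (f : Hom X X') →
               Iso.to (ρ≅ X') ∘ (f ⊗₁ id) ≈ f ∘ Iso.to (ρ≅ X)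
      pentagon : ∀ W X Y Z →
               (id {W} ⊗₁ Iso.to (α X Y Z)) ∘ Iso.to (α W (X ⊗₀ Y) Z) ∘ (Iso.to (α W X Y) ⊗₁ id {Z})
                 ≈ Iso.to (α W X (Y ⊗₀ Z)) ∘ Iso.to (α (W ⊗₀ X) Y Z)
      triangle : ∀ X Y →
               (id {X} ⊗₁ Iso.to (λ≅ Y)) ∘ Iso.to (α X 𝟙 Y) ≈ Iso.to (ρ≅ X) ⊗₁ id {Y}

  record Biclosed {𝟙 : Ob} (M : Monoidal 𝟙) : Set₁ where
    open Monoidal M
    field
      left-closed  : ∀ X → RightAdjoint (λ Y → X ⊗₀ Y) (λ g → id {X} ⊗₁ g)
      right-closed : ∀ X → RightAdjoint (λ Y → Y ⊗₀ X) (λ g → g ⊗₁ id {X})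

  -- Isomorphism of monoidal structures on the same category with the same
  -- unit: a natural isomorphism φ : X ⊗ Y ≅ X ⊗' Y making the identity
  -- functor (with unit comparison the identity) a strong monoidal functor.
  record MonoidalIso {𝟙 : Ob} (M M' : Monoidal 𝟙) : Set₁ where
    open Monoidal M
    open Monoidal M' renaming (_⊗₀_ to _⊗₀'_; _⊗₁_ to _⊗₁'_; α to α'; λ≅ to λ≅'; ρ≅ to ρ≅')
      hiding (⊗-resp; ⊗-id; ⊗-∘; α-nat; λ-nat; ρ-nat; pentagon; triangle)
    field
      φ     : ∀ X Y → Iso (X ⊗₀ Y) (X ⊗₀' Y)
      φ-nat : ∀ {X X' Y Y'} (f : Hom X X') (g : Hom Y Y') →
              Iso.to (φ X' Y') ∘ (f ⊗₁ g) ≈ (f ⊗₁' g) ∘ Iso.to (φ X Y)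
      φ-α   : ∀ X Y Z →
              Iso.to (α' X Y Z) ∘ (Iso.to (φ X Y) ⊗₁' id {Z}) ∘ Iso.to (φ (X ⊗₀ Y) Z)
                ≈ (id {X} ⊗₁' Iso.to (φ Y Z)) ∘ Iso.to (φ X (Y ⊗₀ Z)) ∘ Iso.to (α X Y Z)
      φ-λ   : ∀ X → Iso.to (λ≅' X) ∘ Iso.to (φ 𝟙 X) ≈ Iso.to (λ≅ X)
      φ-ρ   : ∀ X → Iso.to (ρ≅' X) ∘ Iso.to (φ X 𝟙) ≈ Iso.to (ρ≅ X)

  -- "The object A ⊗ A of M and of M' agree": an isomorphism
  -- A ⊗ A ≅ A ⊗' A respecting the canonical vertices, i.e. commuting with
  -- the maps a ⊗ b : 𝟙 ≅ 𝟙 ⊗ 𝟙 → A ⊗ A for all points a b : 𝟙 → A.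
  record SameSquare {𝟙 : Ob} (M M' : Monoidal 𝟙) (A : Ob) : Set where
    open Monoidal M
    open Monoidal M' renaming (_⊗₀_ to _⊗₀'_; _⊗₁_ to _⊗₁'_; ρ≅ to ρ≅')
      hiding (α; λ≅; ⊗-resp; ⊗-id; ⊗-∘; α-nat; λ-nat; ρ-nat; pentagon; triangle)
    field
      iso    : Iso (A ⊗₀ A) (A ⊗₀' A)
      points : ∀ (a b : Hom 𝟙 A) →
               Iso.to iso ∘ (a ⊗₁ b) ∘ Iso.from (ρ≅ 𝟙) ≈ (a ⊗₁' b) ∘ Iso.from (ρ≅' 𝟙)

module DiG = Cat {DiGraph} (λ X → X)
module UG  = Cat {Graph} dg

{-# OPTIONS --safe #-}
module Submission where

open import Defs
open import Data.Bool using (true; false; if_then_else_; _≤_; b≤b; f≤t)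
open import Data.Product using (Σ; _×_; _,_; proj₁; proj₂)
open import Data.Unit using (tt)
open import Relation.Binary.PropositionalEquality
open ≡-Reasoning

-- Write ⟪ x , y ⟫ for the vertex x ⊗ y : 𝟙 ≅ 𝟙 ⊗ 𝟙 → X ⊗ Y.  Since X ⊗ - and - ⊗ Y are
-- left adjoints and vertices are maps out of the one-vertex unit, two maps out of X ⊗ Y
-- agreeing on all pairs ⟪ x , y ⟫ are equal.  Left adjoints also preserve the way a graph
-- is glued from its vertices and copies of the walking edge A (= J₁ or I₁), so a map out
-- of X ⊗ Y is specified by maps out of X ⊗ 𝟙 ≅ X, one for each vertex of Y, and out of X ⊗ A,
-- one for each edge of Y, matching at the endpoints; symmetrically in the left factor.
-- Gluing twice extends the identification A ⊗ A ≅ A ⊗' A to maps X ⊗ Y → X ⊗' Y that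
-- preserve pairs, in both directions, and every axiom of a monoidal isomorphism holds
-- because it holds on pairs.

module OnePointUnit {Ob : Set₁} (U : Ob → DiGraph)
                    (𝟙 : Ob) (⋆ : V (U 𝟙)) (⋆-unique : ∀ s → s ≡ ⋆) where
  open Cat U

  point : ∀ {X} → V (U X) → Hom 𝟙 X
  point {X} x = record { fun = λ _ → x ; pres = λ _ → E-refl (U X) x }

  Subsingleton : Ob → Set
  Subsingleton X = ∀ (v w : V (U X)) → v ≡ w

  𝟙-subsingleton : Subsingleton 𝟙
  𝟙-subsingleton s t = trans (⋆-unique s) (sym (⋆-unique t))

  Iso⇒Subsingleton : ∀ {X Y} → Iso X Y → Subsingleton Y → Subsingleton X
  Iso⇒Subsingleton i Y-sub v w = begin
    v                                    ≡⟨ Iso.from∘to i v ⟨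
    fun (Iso.from i) (fun (Iso.to i) v)  ≡⟨ cong (fun (Iso.from i)) (Y-sub _ _) ⟩
    fun (Iso.from i) (fun (Iso.to i) w)  ≡⟨ Iso.from∘to i w ⟩
    w                                    ∎

  point-𝟙 : ∀ s → point {𝟙} s ≈ id
  point-𝟙 = 𝟙-subsingleton

  module LeftAdjoint {F₀ : Ob → Ob} {F₁ : ∀ {Y Y'} → Hom Y Y' → Hom (F₀ Y) (F₀ Y')}
    (F₁-resp : ∀ {Y Y'} {g g' : Hom Y Y'} → g ≈ g' → F₁ g ≈ F₁ g')
    (F₁-∘ : ∀ {Y Y' Y''} {g : Hom Y Y'} {g' : Hom Y' Y''} → F₁ (g' ∘ g) ≈ F₁ g' ∘ F₁ g)
    (adjoint : RightAdjoint F₀ F₁) where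
    open RightAdjoint adjoint

    transpose : ∀ {Y Z} → Hom (F₀ Y) Z → Hom Y (R Z)
    transpose f = proj₁ (univ f)

    ε-transpose : ∀ {Y Z} (f : Hom (F₀ Y) Z) → ε Z ∘ F₁ (transpose f) ≈ f
    ε-transpose f = proj₁ (proj₂ (univ f))

    transpose-unique : ∀ {Y Z} {f : Hom (F₀ Y) Z} (g : Hom Y (R Z)) →
                       ε Z ∘ F₁ g ≈ f → g ≈ transpose f
    transpose-unique {f = f} = proj₂ (proj₂ (univ f))

    transpose-resp : ∀ {Y Z} {f f' : Hom (F₀ Y) Z} → f ≈ f' → transpose f ≈ transpose f'
    transpose-resp {f = f} f≈f' =
      transpose-unique (transpose f) λ v → trans (ε-transpose f v) (f≈f' v)

    transpose-∘ : ∀ {Y Y' Z} (f : Hom (F₀ Y) Z) (g : Hom Y' Y) →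
                  transpose f ∘ g ≈ transpose (f ∘ F₁ g)
    transpose-∘ {Z = Z} f g = transpose-unique (transpose f ∘ g) λ v → begin
      fun (ε Z) (fun (F₁ (transpose f ∘ g)) v)          ≡⟨ cong (fun (ε Z)) (F₁-∘ v) ⟩
      fun (ε Z) (fun (F₁ (transpose f)) (fun (F₁ g) v)) ≡⟨ ε-transpose f _ ⟩
      fun f (fun (F₁ g) v)                              ∎

    points-jointly-epic : ∀ {Y W} (f g : Hom (F₀ Y) W) →
                          (∀ y → f ∘ F₁ (point y) ≈ g ∘ F₁ (point y)) → f ≈ g
    points-jointly-epic {W = W} f g agree v = begin
      fun f v                                ≡⟨ sym (ε-transpose f v) ⟩
      fun (ε W) (fun (F₁ (transpose f)) v)   ≡⟨ cong (fun (ε W)) (F₁-resp transposes-agree v) ⟩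
      fun (ε W) (fun (F₁ (transpose g)) v)   ≡⟨ ε-transpose g v ⟩
      fun g v                                ∎
      where
      transposes-agree : transpose f ≈ transpose g
      transposes-agree y = begin
        fun (transpose f) y                      ≡⟨ transpose-∘ f (point y) ⋆ ⟩
        fun (transpose (f ∘ F₁ (point y))) ⋆     ≡⟨ transpose-resp (agree y) ⋆ ⟩
        fun (transpose (g ∘ F₁ (point y))) ⋆     ≡⟨ transpose-∘ g (point y) ⋆ ⟨
        fun (transpose g) y                      ∎

    glue : ∀ {A a₀ a₁} → E (U A) a₀ a₁ → ∀ {Y W}
           (φ : V (U Y) → Hom (F₀ 𝟙) W) (ψ : ∀ {y y'} → E (U Y) y y' → Hom (F₀ A) W) →
           (∀ {y y'} (e : E (U Y) y y') → ψ e ∘ F₁ (point a₀) ≈ φ y) →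
           (∀ {y y'} (e : E (U Y) y y') → ψ e ∘ F₁ (point a₁) ≈ φ y') →
           Σ (Hom (F₀ Y) W) λ Φ → ∀ y → Φ ∘ F₁ (point y) ≈ φ y
    glue a₀⇝a₁ {Y} {W} φ ψ ψ-a₀ ψ-a₁ = ε W ∘ F₁ G , G-glues
      where
      ends : ∀ {y y' a y₀} (e : E (U Y) y y') → ψ e ∘ F₁ (point a) ≈ φ y₀ →
             fun (transpose (ψ e)) a ≡ fun (transpose (φ y₀)) ⋆
      ends {a = a} e p = trans (transpose-∘ (ψ e) (point a) ⋆) (transpose-resp p ⋆)

      G : Hom Y (R W)
      G = record
        { fun  = λ y → fun (transpose (φ y)) ⋆
        ; pres = λ e → subst₂ (E (U (R W))) (ends e (ψ-a₀ e)) (ends e (ψ-a₁ e))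
                                            (pres (transpose (ψ e)) a₀⇝a₁)
        }

      G∘point : ∀ y → G ∘ point y ≈ transpose (φ y)
      G∘point y s = cong (fun (transpose (φ y))) (sym (⋆-unique s))

      G-glues : ∀ y → (ε W ∘ F₁ G) ∘ F₁ (point y) ≈ φ y
      G-glues y v = begin
        fun (ε W) (fun (F₁ G) (fun (F₁ (point y)) v)) ≡⟨ cong (fun (ε W)) (F₁-∘ v) ⟨
        fun (ε W) (fun (F₁ (G ∘ point y)) v)          ≡⟨ cong (fun (ε W)) (F₁-resp (G∘point y) v) ⟩
        fun (ε W) (fun (F₁ (transpose (φ y))) v)      ≡⟨ ε-transpose (φ y) v ⟩
        fun (φ y) v                                   ∎

  module Pairing (M : Monoidal 𝟙) where
    open Monoidal M

    ⟪_,_⟫ : ∀ {X Y} → V (U X) → V (U Y) → V (U (X ⊗₀ Y))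
    ⟪ x , y ⟫ = fun (point x ⊗₁ point y) (fun (Iso.from (ρ≅ 𝟙)) ⋆)

    ⊗₁-⟪⟫ : ∀ {X X' Y Y'} (f : Hom X X') (g : Hom Y Y') x y →
            fun (f ⊗₁ g) ⟪ x , y ⟫ ≡ ⟪ fun f x , fun g y ⟫
    ⊗₁-⟪⟫ f g x y = trans (sym (⊗-∘ {f = point x} {f' = f} {g = point y} {g' = g} _))
                          (⊗-resp {f = f ∘ point x} {f' = point (fun f x)}
                                  {g = g ∘ point y} {g' = point (fun g y)}
                                  (λ _ → refl) (λ _ → refl) _)

    ρ-⟪⟫ : ∀ {X} (x : V (U X)) s → fun (Iso.to (ρ≅ X)) ⟪ x , s ⟫ ≡ x
    ρ-⟪⟫ {X} x s = trans (cong (fun (Iso.to (ρ≅ X)))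
                           (⊗-resp {f = point x} {f' = point x} (λ _ → refl) (point-𝟙 s) _))
                         (ρ-nat (point x) _)

    λ-⟪⟫ : ∀ {Y} s (y : V (U Y)) → fun (Iso.to (λ≅ Y)) ⟪ s , y ⟫ ≡ y
    λ-⟪⟫ {Y} s y = trans (cong (fun (Iso.to (λ≅ Y)))
                           (⊗-resp {g = point y} {g' = point y} (point-𝟙 s) (λ _ → refl) _))
                         (λ-nat (point y) _)

    ρ⁻¹-⟪⟫ : ∀ {X} (x : V (U X)) → fun (Iso.from (ρ≅ X)) x ≡ ⟪ x , ⋆ ⟫
    ρ⁻¹-⟪⟫ {X} x = trans (cong (fun (Iso.from (ρ≅ X))) (sym (ρ-⟪⟫ x ⋆)))
                         (Iso.from∘to (ρ≅ X) _)

    λ⁻¹-⟪⟫ : ∀ {Y} (y : V (U Y)) → fun (Iso.from (λ≅ Y)) y ≡ ⟪ ⋆ , y ⟫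
    λ⁻¹-⟪⟫ {Y} y = trans (cong (fun (Iso.from (λ≅ Y))) (sym (λ-⟪⟫ ⋆ y)))
                         (Iso.from∘to (λ≅ Y) _)

    id⊗point : ∀ {X Y} (y : V (U Y)) (v : V (U (X ⊗₀ 𝟙))) →
               fun (id ⊗₁ point y) v ≡ ⟪ fun (Iso.to (ρ≅ X)) v , y ⟫
    id⊗point {X} y v = begin
      fun (id ⊗₁ point y) v
        ≡⟨ cong (fun (id ⊗₁ point y)) (Iso.from∘to (ρ≅ X) v) ⟨
      fun (id ⊗₁ point y) (fun (Iso.from (ρ≅ X)) (fun (Iso.to (ρ≅ X)) v))
        ≡⟨ cong (fun (id ⊗₁ point y)) (ρ⁻¹-⟪⟫ _) ⟩
      fun (id ⊗₁ point y) ⟪ fun (Iso.to (ρ≅ X)) v , ⋆ ⟫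
        ≡⟨ ⊗₁-⟪⟫ id (point y) _ ⋆ ⟩
      ⟪ fun (Iso.to (ρ≅ X)) v , y ⟫
        ∎

    point⊗id : ∀ {X Z} (x : V (U X)) (v : V (U (𝟙 ⊗₀ Z))) →
               fun (point x ⊗₁ id) v ≡ ⟪ x , fun (Iso.to (λ≅ Z)) v ⟫
    point⊗id {Z = Z} x v = begin
      fun (point x ⊗₁ id) v
        ≡⟨ cong (fun (point x ⊗₁ id)) (Iso.from∘to (λ≅ Z) v) ⟨
      fun (point x ⊗₁ id) (fun (Iso.from (λ≅ Z)) (fun (Iso.to (λ≅ Z)) v))
        ≡⟨ cong (fun (point x ⊗₁ id)) (λ⁻¹-⟪⟫ _) ⟩
      fun (point x ⊗₁ id) ⟪ ⋆ , fun (Iso.to (λ≅ Z)) v ⟫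
        ≡⟨ ⊗₁-⟪⟫ (point x) id ⋆ _ ⟩
      ⟪ x , fun (Iso.to (λ≅ Z)) v ⟫
        ∎

    ⟪-,_⟫ : ∀ {X Y} → V (U Y) → Hom X (X ⊗₀ Y)
    ⟪-, y ⟫ = (id ⊗₁ point y) ∘ Iso.from (ρ≅ _)

    ⟪_,-⟫ : ∀ {X Z} → V (U X) → Hom Z (X ⊗₀ Z)
    ⟪ x ,-⟫ = (point x ⊗₁ id) ∘ Iso.from (λ≅ _)

    fun-⟪-,⟫ : ∀ {X Y} (x : V (U X)) (y : V (U Y)) → fun ⟪-, y ⟫ x ≡ ⟪ x , y ⟫
    fun-⟪-,⟫ {X} x y = trans (id⊗point y _) (cong ⟪_, y ⟫ (Iso.to∘from (ρ≅ X) x))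

    fun-⟪,-⟫ : ∀ {X Z} (x : V (U X)) (z : V (U Z)) → fun ⟪ x ,-⟫ z ≡ ⟪ x , z ⟫
    fun-⟪,-⟫ {Z = Z} x z = trans (point⊗id x _) (cong ⟪ x ,_⟫ (Iso.to∘from (λ≅ Z) z))

    𝟙⊗[𝟙⊗𝟙]-subsingleton : Subsingleton (𝟙 ⊗₀ (𝟙 ⊗₀ 𝟙))
    𝟙⊗[𝟙⊗𝟙]-subsingleton =
      Iso⇒Subsingleton (λ≅ _) (Iso⇒Subsingleton (λ≅ 𝟙) 𝟙-subsingleton)

    α-⟪⟫ : ∀ {X Y Z} (x : V (U X)) (y : V (U Y)) (z : V (U Z)) →
           fun (Iso.to (α X Y Z)) ⟪ ⟪ x , y ⟫ , z ⟫ ≡ ⟪ x , ⟪ y , z ⟫ ⟫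
    α-⟪⟫ {X} {Y} {Z} x y z = begin
      fun (Iso.to (α X Y Z)) ⟪ ⟪ x , y ⟫ , z ⟫
        ≡⟨ cong (fun (Iso.to (α X Y Z))) lhs ⟨
      fun (Iso.to (α X Y Z)) (fun ((point x ⊗₁ point y) ⊗₁ point z) ⟪ ⟪ ⋆ , ⋆ ⟫ , ⋆ ⟫)
        ≡⟨ α-nat (point x) (point y) (point z) _ ⟩
      fun (point x ⊗₁ (point y ⊗₁ point z)) (fun (Iso.to (α 𝟙 𝟙 𝟙)) ⟪ ⟪ ⋆ , ⋆ ⟫ , ⋆ ⟫)
        ≡⟨ cong (fun (point x ⊗₁ (point y ⊗₁ point z))) (𝟙⊗[𝟙⊗𝟙]-subsingleton _ _) ⟩
      fun (point x ⊗₁ (point y ⊗₁ point z)) ⟪ ⋆ , ⟪ ⋆ , ⋆ ⟫ ⟫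
        ≡⟨ rhs ⟩
      ⟪ x , ⟪ y , z ⟫ ⟫
        ∎
      where
      lhs : fun ((point x ⊗₁ point y) ⊗₁ point z) ⟪ ⟪ ⋆ , ⋆ ⟫ , ⋆ ⟫ ≡ ⟪ ⟪ x , y ⟫ , z ⟫
      lhs = trans (⊗₁-⟪⟫ (point x ⊗₁ point y) (point z) _ ⋆)
                  (cong ⟪_, z ⟫ (⊗₁-⟪⟫ (point x) (point y) ⋆ ⋆))
      rhs : fun (point x ⊗₁ (point y ⊗₁ point z)) ⟪ ⋆ , ⟪ ⋆ , ⋆ ⟫ ⟫ ≡ ⟪ x , ⟪ y , z ⟫ ⟫
      rhs = trans (⊗₁-⟪⟫ (point x) (point y ⊗₁ point z) ⋆ _)
                  (cong ⟪ x ,_⟫ (⊗₁-⟪⟫ (point y) (point z) ⋆ ⋆))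

  module Closed (M : Monoidal 𝟙) (B : Biclosed M) where
    open Monoidal M
    open Pairing M
    open Biclosed B

    module X⊗- X = LeftAdjoint (⊗-resp (λ _ → refl)) ⊗-∘ (left-closed X)
    module -⊗Z Z = LeftAdjoint (λ e → ⊗-resp e (λ _ → refl)) ⊗-∘ (right-closed Z)

    pairs-jointly-epic : ∀ {X Y W} (f g : Hom (X ⊗₀ Y) W) →
                         (∀ x y → fun f ⟪ x , y ⟫ ≡ fun g ⟪ x , y ⟫) → f ≈ g
    pairs-jointly-epic {X} f g agree = X⊗-.points-jointly-epic X f g λ y v → begin
      fun f (fun (id ⊗₁ point y) v)  ≡⟨ cong (fun f) (id⊗point y v) ⟩
      fun f ⟪ _ , y ⟫                ≡⟨ agree _ y ⟩
      fun g ⟪ _ , y ⟫                ≡⟨ cong (fun g) (id⊗point y v) ⟨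
      fun g (fun (id ⊗₁ point y) v)  ∎

    pairs-jointly-epic₃ : ∀ {X Y Z W} (f g : Hom ((X ⊗₀ Y) ⊗₀ Z) W) →
                          (∀ x y z → fun f ⟪ ⟪ x , y ⟫ , z ⟫ ≡ fun g ⟪ ⟪ x , y ⟫ , z ⟫) → f ≈ g
    pairs-jointly-epic₃ f g agree = pairs-jointly-epic f g λ v z → begin
      fun f ⟪ v , z ⟫          ≡⟨ cong (fun f) (fun-⟪-,⟫ v z) ⟨
      fun (f ∘ ⟪-, z ⟫) v      ≡⟨ pairs-jointly-epic (f ∘ ⟪-, z ⟫) (g ∘ ⟪-, z ⟫) (agree-at z) v ⟩
      fun (g ∘ ⟪-, z ⟫) v      ≡⟨ cong (fun g) (fun-⟪-,⟫ v z) ⟩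
      fun g ⟪ v , z ⟫          ∎
      where
      agree-at : ∀ z x y → fun (f ∘ ⟪-, z ⟫) ⟪ x , y ⟫ ≡ fun (g ∘ ⟪-, z ⟫) ⟪ x , y ⟫
      agree-at z x y = begin
        fun f (fun ⟪-, z ⟫ ⟪ x , y ⟫)  ≡⟨ cong (fun f) (fun-⟪-,⟫ _ z) ⟩
        fun f ⟪ ⟪ x , y ⟫ , z ⟫        ≡⟨ agree x y z ⟩
        fun g ⟪ ⟪ x , y ⟫ , z ⟫        ≡⟨ cong (fun g) (fun-⟪-,⟫ _ z) ⟨
        fun g (fun ⟪-, z ⟫ ⟪ x , y ⟫)  ∎

    glue-left : ∀ {A a₀ a₁} → E (U A) a₀ a₁ → ∀ {X Y W} (h : V (U Y) → Hom X W)
                (k : ∀ {y y'} → E (U Y) y y' → Hom (X ⊗₀ A) W) →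
                (∀ {y y'} (e : E (U Y) y y') x → fun (k e) ⟪ x , a₀ ⟫ ≡ fun (h y) x) →
                (∀ {y y'} (e : E (U Y) y y') x → fun (k e) ⟪ x , a₁ ⟫ ≡ fun (h y') x) →
                Σ (Hom (X ⊗₀ Y) W) λ Φ → ∀ x y → fun Φ ⟪ x , y ⟫ ≡ fun (h y) x
    glue-left {a₀ = a₀} {a₁} a₀⇝a₁ {X} {Y} {W} h k k-a₀ k-a₁ = Φ , Φ-⟪⟫
      where
      glued : Σ (Hom (X ⊗₀ Y) W) λ Φ → ∀ y → Φ ∘ (id ⊗₁ point y) ≈ h y ∘ Iso.to (ρ≅ X)
      glued = X⊗-.glue X a₀⇝a₁ (λ y → h y ∘ Iso.to (ρ≅ X)) k
                (λ e v → trans (cong (fun (k e)) (id⊗point a₀ v)) (k-a₀ e _))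
                (λ e v → trans (cong (fun (k e)) (id⊗point a₁ v)) (k-a₁ e _))
      Φ : Hom (X ⊗₀ Y) W
      Φ = proj₁ glued

      Φ-⟪⟫ : ∀ x y → fun Φ ⟪ x , y ⟫ ≡ fun (h y) x
      Φ-⟪⟫ x y = begin
        fun Φ ⟪ x , y ⟫                                ≡⟨ cong (fun Φ) (fun-⟪-,⟫ x y) ⟨
        fun Φ (fun (id ⊗₁ point y) (fun (Iso.from (ρ≅ X)) x))
                                                       ≡⟨ proj₂ glued y _ ⟩
        fun (h y) (fun (Iso.to (ρ≅ X)) (fun (Iso.from (ρ≅ X)) x))
                                                       ≡⟨ cong (fun (h y)) (Iso.to∘from (ρ≅ X) x) ⟩
        fun (h y) x                                    ∎

    glue-right : ∀ {A a₀ a₁} → E (U A) a₀ a₁ → ∀ {X Z W} (h : V (U X) → Hom Z W)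
                 (k : ∀ {x x'} → E (U X) x x' → Hom (A ⊗₀ Z) W) →
                 (∀ {x x'} (e : E (U X) x x') z → fun (k e) ⟪ a₀ , z ⟫ ≡ fun (h x) z) →
                 (∀ {x x'} (e : E (U X) x x') z → fun (k e) ⟪ a₁ , z ⟫ ≡ fun (h x') z) →
                 Σ (Hom (X ⊗₀ Z) W) λ Φ → ∀ x z → fun Φ ⟪ x , z ⟫ ≡ fun (h x) z
    glue-right {a₀ = a₀} {a₁} a₀⇝a₁ {X} {Z} {W} h k k-a₀ k-a₁ = Φ , Φ-⟪⟫
      where
      glued : Σ (Hom (X ⊗₀ Z) W) λ Φ → ∀ x → Φ ∘ (point x ⊗₁ id) ≈ h x ∘ Iso.to (λ≅ Z)
      glued = -⊗Z.glue Z a₀⇝a₁ (λ x → h x ∘ Iso.to (λ≅ Z)) k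
                (λ e v → trans (cong (fun (k e)) (point⊗id a₀ v)) (k-a₀ e _))
                (λ e v → trans (cong (fun (k e)) (point⊗id a₁ v)) (k-a₁ e _))
      Φ : Hom (X ⊗₀ Z) W
      Φ = proj₁ glued

      Φ-⟪⟫ : ∀ x z → fun Φ ⟪ x , z ⟫ ≡ fun (h x) z
      Φ-⟪⟫ x z = begin
        fun Φ ⟪ x , z ⟫                                ≡⟨ cong (fun Φ) (fun-⟪,-⟫ x z) ⟨
        fun Φ (fun (point x ⊗₁ id) (fun (Iso.from (λ≅ Z)) z))
                                                       ≡⟨ proj₂ glued x _ ⟩
        fun (h x) (fun (Iso.to (λ≅ Z)) (fun (Iso.from (λ≅ Z)) z))
                                                       ≡⟨ cong (fun (h x)) (Iso.to∘from (λ≅ Z) z) ⟩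
        fun (h x) z                                    ∎

  module Comparison (M M' : Monoidal 𝟙) where
    open Monoidal M using (_⊗₀_)
    open Monoidal M' using () renaming (_⊗₀_ to _⊗₀'_)
    open Pairing M using (⟪_,_⟫)
    open Pairing M' using () renaming (⟪_,_⟫ to ⟪_,_⟫')

    record PairPreserving (X Y : Ob) : Set where
      field
        map    : Hom (X ⊗₀ Y) (X ⊗₀' Y)
        map-⟪⟫ : ∀ x y → fun map ⟪ x , y ⟫ ≡ ⟪ x , y ⟫'

  module EdgeCorepresented {A : Ob} {a₀ a₁ : V (U A)} (a₀⇝a₁ : E (U A) a₀ a₁)
    (edge-map : ∀ {X x x'} → E (U X) x x' → Hom A X)
    (edge-map-a₀ : ∀ {X x x'} (e : E (U X) x x') → fun (edge-map e) a₀ ≡ x)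
    (edge-map-a₁ : ∀ {X x x'} (e : E (U X) x x') → fun (edge-map e) a₁ ≡ x') where

    module Extension (M M' : Monoidal 𝟙) (B : Biclosed M) where
      open Monoidal M using (_⊗₀_)
      open Monoidal M' using () renaming (_⊗₀_ to _⊗₀'_; _⊗₁_ to _⊗₁'_)
      open Pairing M using (⟪_,_⟫)
      open Pairing M' using () renaming
        (⟪_,_⟫ to ⟪_,_⟫'; ⊗₁-⟪⟫ to ⊗₁-⟪⟫'; ⟪-,_⟫ to ⟪-,_⟫'; ⟪_,-⟫ to ⟪_,-⟫';
         fun-⟪-,⟫ to fun-⟪-,⟫'; fun-⟪,-⟫ to fun-⟪,-⟫')
      open Closed M B using (glue-left; glue-right)
      open Comparison M M'
      open PairPreserving

      extendˡ : PairPreserving A A → ∀ X → PairPreserving X A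
      extendˡ square X = record
        { map    = proj₁ glued
        ; map-⟪⟫ = λ x a → trans (proj₂ glued x a) (fun-⟪,-⟫' x a)
        }
        where
        k : ∀ {x x'} → E (U X) x x' → Hom (A ⊗₀ A) (X ⊗₀' A)
        k e = (edge-map e ⊗₁' id) ∘ map square

        k-⟪⟫ : ∀ {x x'} (e : E (U X) x x') b a →
               fun (k e) ⟪ b , a ⟫ ≡ fun ⟪ fun (edge-map e) b ,-⟫' a
        k-⟪⟫ e b a = begin
          fun (edge-map e ⊗₁' id) (fun (map square) ⟪ b , a ⟫)
            ≡⟨ cong (fun (edge-map e ⊗₁' id)) (map-⟪⟫ square b a) ⟩
          fun (edge-map e ⊗₁' id) ⟪ b , a ⟫'
            ≡⟨ ⊗₁-⟪⟫' (edge-map e) id b a ⟩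
          ⟪ fun (edge-map e) b , a ⟫'
            ≡⟨ fun-⟪,-⟫' _ a ⟨
          fun ⟪ fun (edge-map e) b ,-⟫' a
            ∎

        glued : Σ (Hom (X ⊗₀ A) (X ⊗₀' A)) λ Φ → ∀ x a → fun Φ ⟪ x , a ⟫ ≡ fun ⟪ x ,-⟫' a
        glued = glue-right a₀⇝a₁ ⟪_,-⟫' k
                  (λ e a → trans (k-⟪⟫ e a₀ a) (cong (λ x → fun ⟪ x ,-⟫' a) (edge-map-a₀ e)))
                  (λ e a → trans (k-⟪⟫ e a₁ a) (cong (λ x → fun ⟪ x ,-⟫' a) (edge-map-a₁ e)))

      extend : PairPreserving A A → ∀ X Y → PairPreserving X Y
      extend square X Y = record
        { map    = proj₁ glued
        ; map-⟪⟫ = λ x y → trans (proj₂ glued x y) (fun-⟪-,⟫' x y)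
        }
        where
        k : ∀ {y y'} → E (U Y) y y' → Hom (X ⊗₀ A) (X ⊗₀' Y)
        k e = (id ⊗₁' edge-map e) ∘ map (extendˡ square X)

        k-⟪⟫ : ∀ {y y'} (e : E (U Y) y y') x b →
               fun (k e) ⟪ x , b ⟫ ≡ fun ⟪-, fun (edge-map e) b ⟫' x
        k-⟪⟫ e x b = begin
          fun (id ⊗₁' edge-map e) (fun (map (extendˡ square X)) ⟪ x , b ⟫)
            ≡⟨ cong (fun (id ⊗₁' edge-map e)) (map-⟪⟫ (extendˡ square X) x b) ⟩
          fun (id ⊗₁' edge-map e) ⟪ x , b ⟫'
            ≡⟨ ⊗₁-⟪⟫' id (edge-map e) x b ⟩
          ⟪ x , fun (edge-map e) b ⟫'
            ≡⟨ fun-⟪-,⟫' x _ ⟨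
          fun ⟪-, fun (edge-map e) b ⟫' x
            ∎

        glued : Σ (Hom (X ⊗₀ Y) (X ⊗₀' Y)) λ Φ → ∀ x y → fun Φ ⟪ x , y ⟫ ≡ fun ⟪-, y ⟫' x
        glued = glue-left a₀⇝a₁ ⟪-,_⟫' k
                  (λ e x → trans (k-⟪⟫ e x a₀) (cong (λ y → fun ⟪-, y ⟫' x) (edge-map-a₀ e)))
                  (λ e x → trans (k-⟪⟫ e x a₁) (cong (λ y → fun ⟪-, y ⟫' x) (edge-map-a₁ e)))

    module Reconstruction (M M' : Monoidal 𝟙) (B : Biclosed M) (B' : Biclosed M')
                          (S : SameSquare M M' A) where
      open Monoidal M
      open Monoidal M' using () renaming
        (_⊗₀_ to _⊗₀'_; _⊗₁_ to _⊗₁'_; α to α'; λ≅ to λ≅'; ρ≅ to ρ≅')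
      open Pairing M
      open Pairing M' using () renaming
        (⟪_,_⟫ to ⟪_,_⟫'; ⊗₁-⟪⟫ to ⊗₁-⟪⟫'; α-⟪⟫ to α'-⟪⟫; λ-⟪⟫ to λ'-⟪⟫; ρ-⟪⟫ to ρ'-⟪⟫)
      open Closed M B using (pairs-jointly-epic; pairs-jointly-epic₃)
      open Closed M' B' using () renaming (pairs-jointly-epic to pairs-jointly-epic')
      open Comparison using (PairPreserving)
      open Comparison.PairPreserving
      open SameSquare S using (iso; points)

      square : PairPreserving M M' A A
      square = record { map = Iso.to iso ; map-⟪⟫ = λ a b → points (point a) (point b) ⋆ }

      square⁻¹ : PairPreserving M' M A A
      square⁻¹ = record
        { map    = Iso.from iso
        ; map-⟪⟫ = λ a b → trans (cong (fun (Iso.from iso)) (sym (map-⟪⟫ square a b)))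
                                 (Iso.from∘to iso _)
        }

      abstract
        comparison : ∀ X Y → PairPreserving M M' X Y
        comparison = Extension.extend M M' B square

        comparison⁻¹ : ∀ X Y → PairPreserving M' M X Y
        comparison⁻¹ = Extension.extend M' M B' square⁻¹

      to : ∀ X Y → Hom (X ⊗₀ Y) (X ⊗₀' Y)
      to X Y = map (comparison X Y)

      from : ∀ X Y → Hom (X ⊗₀' Y) (X ⊗₀ Y)
      from X Y = map (comparison⁻¹ X Y)

      to-⟪⟫ : ∀ {X Y} x y → fun (to X Y) ⟪ x , y ⟫ ≡ ⟪ x , y ⟫'
      to-⟪⟫ {X} {Y} = map-⟪⟫ (comparison X Y)

      from-⟪⟫ : ∀ {X Y} x y → fun (from X Y) ⟪ x , y ⟫' ≡ ⟪ x , y ⟫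
      from-⟪⟫ {X} {Y} = map-⟪⟫ (comparison⁻¹ X Y)

      φ : ∀ X Y → Iso (X ⊗₀ Y) (X ⊗₀' Y)
      φ X Y = record
        { to      = to X Y
        ; from    = from X Y
        ; from∘to = pairs-jointly-epic (from X Y ∘ to X Y) id λ x y →
                      trans (cong (fun (from X Y)) (to-⟪⟫ x y)) (from-⟪⟫ x y)
        ; to∘from = pairs-jointly-epic' (to X Y ∘ from X Y) id λ x y →
                      trans (cong (fun (to X Y)) (from-⟪⟫ x y)) (to-⟪⟫ x y)
        }

      φ-nat : ∀ {X X' Y Y'} (f : Hom X X') (g : Hom Y Y') →
              to X' Y' ∘ (f ⊗₁ g) ≈ (f ⊗₁' g) ∘ to X Y
      φ-nat {X} {X'} {Y} {Y'} f g =
        pairs-jointly-epic (to X' Y' ∘ (f ⊗₁ g)) ((f ⊗₁' g) ∘ to X Y) λ x y → begin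
        fun (to _ _) (fun (f ⊗₁ g) ⟪ x , y ⟫)   ≡⟨ cong (fun (to _ _)) (⊗₁-⟪⟫ f g x y) ⟩
        fun (to _ _) ⟪ fun f x , fun g y ⟫      ≡⟨ to-⟪⟫ _ _ ⟩
        ⟪ fun f x , fun g y ⟫'                  ≡⟨ ⊗₁-⟪⟫' f g x y ⟨
        fun (f ⊗₁' g) ⟪ x , y ⟫'                ≡⟨ cong (fun (f ⊗₁' g)) (to-⟪⟫ x y) ⟨
        fun (f ⊗₁' g) (fun (to _ _) ⟪ x , y ⟫)  ∎

      φ-α : ∀ X Y Z →
            Iso.to (α' X Y Z) ∘ (to X Y ⊗₁' id {Z}) ∘ to (X ⊗₀ Y) Z
              ≈ (id {X} ⊗₁' to Y Z) ∘ to X (Y ⊗₀ Z) ∘ Iso.to (α X Y Z)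
      φ-α X Y Z = pairs-jointly-epic₃
                    (Iso.to (α' X Y Z) ∘ (to X Y ⊗₁' id {Z}) ∘ to (X ⊗₀ Y) Z)
                    ((id {X} ⊗₁' to Y Z) ∘ to X (Y ⊗₀ Z) ∘ Iso.to (α X Y Z)) λ x y z → begin
        fun (Iso.to (α' X Y Z)) (fun (to X Y ⊗₁' id) (fun (to (X ⊗₀ Y) Z) ⟪ ⟪ x , y ⟫ , z ⟫))
          ≡⟨ cong (λ v → fun (Iso.to (α' X Y Z)) (fun (to X Y ⊗₁' id) v)) (to-⟪⟫ _ z) ⟩
        fun (Iso.to (α' X Y Z)) (fun (to X Y ⊗₁' id) ⟪ ⟪ x , y ⟫ , z ⟫')
          ≡⟨ cong (fun (Iso.to (α' X Y Z))) (⊗₁-⟪⟫' (to X Y) id _ z) ⟩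
        fun (Iso.to (α' X Y Z)) ⟪ fun (to X Y) ⟪ x , y ⟫ , z ⟫'
          ≡⟨ cong (λ v → fun (Iso.to (α' X Y Z)) ⟪ v , z ⟫') (to-⟪⟫ x y) ⟩
        fun (Iso.to (α' X Y Z)) ⟪ ⟪ x , y ⟫' , z ⟫'
          ≡⟨ α'-⟪⟫ x y z ⟩
        ⟪ x , ⟪ y , z ⟫' ⟫'
          ≡⟨ cong ⟪ x ,_⟫' (to-⟪⟫ y z) ⟨
        ⟪ x , fun (to Y Z) ⟪ y , z ⟫ ⟫'
          ≡⟨ ⊗₁-⟪⟫' id (to Y Z) x _ ⟨
        fun (id ⊗₁' to Y Z) ⟪ x , ⟪ y , z ⟫ ⟫'
          ≡⟨ cong (fun (id ⊗₁' to Y Z)) (to-⟪⟫ x _) ⟨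
        fun (id ⊗₁' to Y Z) (fun (to X (Y ⊗₀ Z)) ⟪ x , ⟪ y , z ⟫ ⟫)
          ≡⟨ cong (λ v → fun (id ⊗₁' to Y Z) (fun (to X (Y ⊗₀ Z)) v)) (α-⟪⟫ x y z) ⟨
        fun (id ⊗₁' to Y Z) (fun (to X (Y ⊗₀ Z)) (fun (Iso.to (α X Y Z)) ⟪ ⟪ x , y ⟫ , z ⟫))
          ∎

      φ-λ : ∀ X → Iso.to (λ≅' X) ∘ to 𝟙 X ≈ Iso.to (λ≅ X)
      φ-λ X = pairs-jointly-epic (Iso.to (λ≅' X) ∘ to 𝟙 X) (Iso.to (λ≅ X)) λ s x →
        trans (cong (fun (Iso.to (λ≅' X))) (to-⟪⟫ s x)) (trans (λ'-⟪⟫ s x) (sym (λ-⟪⟫ s x)))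

      φ-ρ : ∀ X → Iso.to (ρ≅' X) ∘ to X 𝟙 ≈ Iso.to (ρ≅ X)
      φ-ρ X = pairs-jointly-epic (Iso.to (ρ≅' X) ∘ to X 𝟙) (Iso.to (ρ≅ X)) λ x s →
        trans (cong (fun (Iso.to (ρ≅' X))) (to-⟪⟫ x s)) (trans (ρ'-⟪⟫ x s) (sym (ρ-⟪⟫ x s)))

      monoidalIso : MonoidalIso M M'
      monoidalIso = record { φ = φ ; φ-nat = φ-nat ; φ-α = φ-α ; φ-λ = φ-λ ; φ-ρ = φ-ρ }

J₁-edge-map : ∀ {X : DiGraph} {x x' : V X} → E X x x' → DHom J₁ X
J₁-edge-map {X} {x} {x'} e = record { fun = λ b → if b then x' else x ; pres = preserves }
  where
  preserves : ∀ {b b'} → b ≤ b' → E X (if b then x' else x) (if b' then x' else x)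
  preserves {false} b≤b = E-refl X x
  preserves {true}  b≤b = E-refl X x'
  preserves f≤t         = e

I₁-edge-map : ∀ {X : Graph} {x x' : V (dg X)} → E (dg X) x x' → DHom (dg I₁) (dg X)
I₁-edge-map {X} {x} {x'} e =
  record { fun = λ b → if b then x' else x ; pres = λ {b} {b'} _ → preserves b b' }
  where
  preserves : ∀ b b' → E (dg X) (if b then x' else x) (if b' then x' else x)
  preserves false false = E-refl (dg X) x
  preserves true  true  = E-refl (dg X) x'
  preserves false true  = e
  preserves true  false = E-sym X e

module DiGraphs = OnePointUnit {DiGraph} (λ X → X) J₀ tt (λ _ → refl)
module DiGraphEdges = DiGraphs.EdgeCorepresented f≤t J₁-edge-map (λ _ → refl) (λ _ → refl)

module Graphs = OnePointUnit {Graph} dg I₀ tt (λ _ → refl)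
module GraphEdges = Graphs.EdgeCorepresented tt (λ {X} → I₁-edge-map {X}) (λ _ → refl) (λ _ → refl)

mainTheorem5 :
    (∀ (M M' : DiG.Monoidal J₀) → DiG.Biclosed M → DiG.Biclosed M' →
       DiG.SameSquare M M' J₁ → DiG.MonoidalIso M M')
    ×
    (∀ (M M' : UG.Monoidal I₀) → UG.Biclosed M → UG.Biclosed M' →
       UG.SameSquare M M' I₁ → UG.MonoidalIso M M')
mainTheorem5 = DiGraphEdges.Reconstruction.monoidalIso , GraphEdges.Reconstruction.monoidalIso
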